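{- Let $k \geq 2$ be an integer and suppose the following holds in $\mathbb{F}_2^k$: for any nonzero vectors $x_1, \dots, x_{2^{k-1}} \in \mathbb{F}_2^k$ with $\sum_i x_i = 0$, there exist vectors $p_1, q_1, \dots, p_{2^{k-1}}, q_{2^{k-1}}$ forming exactly the $2^k$ elements of $\mathbb{F}_2^k$ (each once) with $p_i + q_i = x_i$ for all $i$. Then for every $n \geq k$ and every choice of nonzero vectors $v_1, \dots, v_{2^{n-1}} \in \mathbb{F}_2^n$ with $\sum_{i=1}^{2^{n-1}} v_i = 0$ and $\dim(\mathrm{span}\{v_1, \dots, v_{2^{n-1}}\}) \leq k$, there exist vectors $p_1, q_1, \dots, p_{2^{n-1}}, q_{2^{n-1}}$ forming exactly the $2^n$ elements of $\mathbb{F}_2^n$ (each once) with $p_i + q_i = v_i$ for all $1 \leq i \leq 2^{n-1}$. -}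

module Defs where

open import Data.Bool using (Bool; false; true; _xor_)
open import Data.Nat using (ℕ; zero; suc; _^_; _∸_)
open import Data.Fin using (Fin; zero; suc)
open import Data.Vec using (Vec; replicate; zipWith)
open import Data.Sum using (_⊎_; [_,_]′)
open import Data.Product using (Σ; ∃; _×_; _,_)
open import Relation.Binary.PropositionalEquality using (_≡_)
open import Relation.Nullary using (¬_)
open import Function.Definitions using (Bijective)
open import Function using (_∘_)

-- The vector space 𝔽₂ⁿ, with 𝔽₂ = Bool (false = 0, true = 1, + = xor).
F₂^ : ℕ → Set
F₂^ n = Vec Bool n

𝟎 : ∀ {n} → F₂^ n
𝟎 = replicate _ false

infixl 6 _⊕_
_⊕_ : ∀ {n} → F₂^ n → F₂^ n → F₂^ n
_⊕_ = zipWith _xor_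

_·_ : ∀ {n} → Bool → F₂^ n → F₂^ n
true · v = v
false · v = 𝟎

Σᵥ : ∀ {n m} → (Fin m → F₂^ n) → F₂^ n
Σᵥ {m = zero} x = 𝟎
Σᵥ {m = suc m} x = x zero ⊕ Σᵥ (x ∘ suc)

InSpan : ∀ {n m} → (Fin m → F₂^ n) → F₂^ n → Set
InSpan w v = Σ (Fin _ → Bool) λ c → v ≡ Σᵥ (λ j → c j · w j)

-- dim (span {v_i}) ≤ d : span{v_i} is contained in the span of some d vectors
-- (dimension = minimal size of a spanning set).
DimSpan≤ : ∀ {n m} → (Fin m → F₂^ n) → ℕ → Set
DimSpan≤ {n} {m} v d = Σ (Fin d → F₂^ n) λ w → (i : Fin m) → InSpan w (v i)

half : ℕ → ℕ
half n = 2 ^ (n ∸ 1)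

HasPairing : ∀ n → (Fin (half n) → F₂^ n) → Set
HasPairing n v =
  Σ (Fin (half n) → F₂^ n) λ p →
  Σ (Fin (half n) → F₂^ n) λ q →
    Bijective _≡_ _≡_ [ p , q ]′ × ((i : Fin (half n)) → p i ⊕ q i ≡ v i)

PairingProperty : ℕ → Set
PairingProperty k =
  (x : Fin (half k) → F₂^ k) → ((i : Fin (half k)) → ¬ x i ≡ 𝟎) → Σᵥ x ≡ 𝟎 → HasPairing k x

module Submission where

-- Induction on n, starting at n = k, where it is the hypothesis (`base`).  In the step
-- n → n + 1 (`step`) the 2ⁿ given vectors are nonzero, sum to zero and are spanned by
-- k ≤ n vectors, so
--   1. they lie in a hyperplane H (`annihilator`), which deleting a coordinate
--      identifies with F₂ⁿ (`Hyperplane`);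
--   2. their images in F₂ⁿ split into two halves of 2ⁿ⁻¹ vectors with zero sum each
--      (`halve`, a counting argument that needs n ≥ 2);
--   3. each half has a pairing of F₂ⁿ by induction; lifting one into H and the other
--      into the coset F₂ⁿ⁺¹ ∖ H pairs the original vectors (`lift-pairings`).
-- Multisets are lists up to permutation and pairings are stated for lists
-- (`Pairing`); `base` and `toHasPairing` translate from and to the Fin-indexed form.

open import Defs

open import Algebra.Bundles using (CommutativeRing)
open import Data.Bool using (Bool; false; true; _xor_; _∧_)
import Data.Bool as Bool
open import Data.Bool.Properties
  using (xor-comm; xor-assoc; xor-identityˡ; xor-identityʳ; xor-same; xor-∧-commutativeRing;
         ∧-distribˡ-xor; ∧-zeroʳ; ∧-comm; ¬-not)
open import Algebra.Properties.CommutativeSemigroup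
  (CommutativeRing.+-commutativeSemigroup xor-∧-commutativeRing)
  using () renaming (interchange to xor-interchange)
open import Data.Empty using (⊥; ⊥-elim)
open import Data.Fin using (Fin; zero; suc; punchIn; punchOut)
import Data.Fin as Fin
open import Data.Fin.Properties using (any?; punchIn-punchOut)
open import Data.List using (List; []; _∷_; _++_; map; length; foldr; tabulate; take; drop)
open import Data.List.Properties
  using (length-++; length-map; length-take; length-tabulate; map-++; map-∘; map-cong; map-id-local;
         map-tabulate; tabulate-cong; take++drop≡id; ++-assoc; ∷-injectiveˡ; ∷-injectiveʳ)
open import Data.List.Membership.Propositional using (_∈_; _∉_; find; lose)
import Data.List.Membership.DecPropositional as DecMembership
open import Data.List.Membership.Propositional.Properties
  using (∈-tabulate⁺; ∈-tabulate⁻; ∈-∃++; ∈-++⁺ˡ; ∈-++⁺ʳ; ∈-++⁻; ∈-map⁺; ∈-map⁻)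
open import Data.List.Relation.Unary.Any using (Any; here; there)
import Data.List.Relation.Unary.Any as Any
open import Data.List.Relation.Unary.All using (All; []; _∷_)
import Data.List.Relation.Unary.All as All
import Data.List.Relation.Unary.All.Properties as AllP
open import Data.List.Relation.Unary.All.Properties.Core using (¬Any⇒All¬)
open import Data.List.Relation.Unary.AllPairs using ([]; _∷_)
import Data.List.Relation.Unary.AllPairs as AllPairs
open import Data.List.Relation.Unary.Unique.Propositional using (Unique)
import Data.List.Relation.Unary.Unique.Propositional.Properties as Unique
open import Data.List.Relation.Binary.Permutation.Propositional
  using (_↭_; ↭-refl; ↭-sym; ↭-trans; ↭-reflexive; prep; swap; ↭⇒↭ₛ)
import Data.List.Relation.Binary.Permutation.Propositional as Perm
open import Data.List.Relation.Binary.Permutation.Propositional.Properties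
  using (All-resp-↭; ∈-resp-↭; ↭-length; shift; shifts; ++⁺ˡ; ++-comm)
import Data.List.Relation.Binary.Permutation.Propositional.Properties as PermProps
import Data.List.Relation.Binary.Permutation.Setoid.Properties as SetoidPerm
open import Data.Nat using (ℕ; zero; suc; _+_; _*_; _^_; _∸_; _≤_; _<_; _≤′_; z≤n; s≤s; ≤′-refl; ≤′-step; _≤?_)
open import Data.Nat.Properties
  using (≤-trans; ≤-reflexive; ≤-pred; <-irrefl; ≰⇒>; n≤1+n; n<1+n; m≤m+n; ≤⇒≤′; ≤′⇒≤;
         +-identityʳ; +-comm; +-suc; +-cancelˡ-≡; suc-injective; +-mono-≤; +-monoˡ-≤; +-monoʳ-≤;
         *-monoʳ-≤; m^n>0; m+n≤o⇒n≤o; m≤n+o⇒m∸n≤o; m≤n⇒m⊓n≡m; m+[n∸m]≡n; module ≤-Reasoning)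
open import Data.Nat.Tactic.RingSolver using (solve-∀)
open import Data.Product using (Σ; _×_; _,_; proj₁; proj₂)
open import Data.Sum using (_⊎_; inj₁; inj₂; [_,_]′)
open import Data.Sum.Properties using (inj₁-injective; inj₂-injective)
open import Data.Vec using (_∷_; []; head; tail; insertAt; removeAt; lookup)
open import Data.Vec.Properties
  using (≡-dec; zipWith-comm; zipWith-assoc; zipWith-identityˡ; zipWith-identityʳ;
         removeAt-insertAt; insertAt-removeAt)
open import Function using (_∘_)
open import Function.Definitions using (Bijective)
open import Relation.Binary.Definitions using (DecidableEquality)
open import Relation.Binary.PropositionalEquality
open import Relation.Nullary using (¬_; yes; no; Dec)

⊕-comm : ∀ {n} (x y : F₂^ n) → x ⊕ y ≡ y ⊕ x
⊕-comm = zipWith-comm xor-comm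

⊕-assoc : ∀ {n} (x y z : F₂^ n) → (x ⊕ y) ⊕ z ≡ x ⊕ (y ⊕ z)
⊕-assoc = zipWith-assoc xor-assoc

⊕-identityˡ : ∀ {n} (x : F₂^ n) → 𝟎 ⊕ x ≡ x
⊕-identityˡ = zipWith-identityˡ xor-identityˡ

⊕-identityʳ : ∀ {n} (x : F₂^ n) → x ⊕ 𝟎 ≡ x
⊕-identityʳ = zipWith-identityʳ xor-identityʳ

⊕-self : ∀ {n} (x : F₂^ n) → x ⊕ x ≡ 𝟎
⊕-self []      = refl
⊕-self (a ∷ x) = cong₂ _∷_ (xor-same a) (⊕-self x)

⊕-inverseˡ : ∀ {n} (x y : F₂^ n) → x ⊕ (x ⊕ y) ≡ y
⊕-inverseˡ x y = begin
  x ⊕ (x ⊕ y) ≡⟨ sym (⊕-assoc x x y) ⟩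
  (x ⊕ x) ⊕ y ≡⟨ cong (_⊕ y) (⊕-self x) ⟩
  𝟎 ⊕ y       ≡⟨ ⊕-identityˡ y ⟩
  y           ∎
  where open ≡-Reasoning

⊕-inverseʳ : ∀ {n} (x y : F₂^ n) → (y ⊕ x) ⊕ x ≡ y
⊕-inverseʳ x y = begin
  (y ⊕ x) ⊕ x ≡⟨ ⊕-assoc y x x ⟩
  y ⊕ (x ⊕ x) ≡⟨ cong (y ⊕_) (⊕-self x) ⟩
  y ⊕ 𝟎       ≡⟨ ⊕-identityʳ y ⟩
  y           ∎
  where open ≡-Reasoning

⊕-injectiveˡ : ∀ {n} (x : F₂^ n) {y z} → x ⊕ y ≡ x ⊕ z → y ≡ z
⊕-injectiveˡ x {y} {z} eq = begin
  y           ≡⟨ sym (⊕-inverseˡ x y) ⟩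
  x ⊕ (x ⊕ y) ≡⟨ cong (x ⊕_) eq ⟩
  x ⊕ (x ⊕ z) ≡⟨ ⊕-inverseˡ x z ⟩
  z           ∎
  where open ≡-Reasoning

⊕≡𝟎⇒≡ : ∀ {n} (x y : F₂^ n) → x ⊕ y ≡ 𝟎 → x ≡ y
⊕≡𝟎⇒≡ x y eq = sym (⊕-injectiveˡ x (trans eq (sym (⊕-self x))))

⊕-interchange : ∀ {n} (x y z u : F₂^ n) → (x ⊕ y) ⊕ (z ⊕ u) ≡ (x ⊕ z) ⊕ (y ⊕ u)
⊕-interchange []      []      []      []      = refl
⊕-interchange (a ∷ x) (b ∷ y) (c ∷ z) (d ∷ u) =
  cong₂ _∷_ (xor-interchange a b c d) (⊕-interchange x y z u)

⊕-lcomm : ∀ {n} (x y z : F₂^ n) → x ⊕ (y ⊕ z) ≡ y ⊕ (x ⊕ z)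
⊕-lcomm x y z = trans (sym (⊕-assoc x y z)) (trans (cong (_⊕ z) (⊕-comm x y)) (⊕-assoc y x z))

⊕-transpose : ∀ {n} (c z w : F₂^ n) → c ⊕ z ≡ w → z ≡ c ⊕ w
⊕-transpose c z w c⊕z≡w = trans (sym (⊕-inverseˡ c z)) (cong (c ⊕_) c⊕z≡w)

Nonzero : ∀ {n} → F₂^ n → Set
Nonzero x = ¬ x ≡ 𝟎

-- The bilinear form ⟨f , x⟩ = Σᵢ fᵢ xᵢ.  The maps x ↦ dot f x are exactly the
-- linear forms on F₂ⁿ; a hyperplane is the kernel of one with f ≢ 𝟎.

dot : ∀ {n} → F₂^ n → F₂^ n → Bool
dot []      []      = false
dot (a ∷ f) (b ∷ x) = (a ∧ b) xor dot f x

dot-∷ : ∀ {n} a (f : F₂^ n) (x : F₂^ (suc n)) → dot (a ∷ f) x ≡ (a ∧ head x) xor dot f (tail x)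
dot-∷ a f (b ∷ x) = refl

dot-𝟎ˡ : ∀ {n} (x : F₂^ n) → dot 𝟎 x ≡ false
dot-𝟎ˡ []      = refl
dot-𝟎ˡ (a ∷ x) = dot-𝟎ˡ x

dot-𝟎ʳ : ∀ {n} (f : F₂^ n) → dot f 𝟎 ≡ false
dot-𝟎ʳ []      = refl
dot-𝟎ʳ (a ∷ f) = trans (cong (_xor dot f 𝟎) (∧-zeroʳ a)) (dot-𝟎ʳ f)

dot-⊕ : ∀ {n} (f x y : F₂^ n) → dot f (x ⊕ y) ≡ dot f x xor dot f y
dot-⊕ []      []      []      = refl
dot-⊕ (a ∷ f) (b ∷ x) (c ∷ y) = begin
  (a ∧ (b xor c)) xor dot f (x ⊕ y)
    ≡⟨ cong₂ _xor_ (∧-distribˡ-xor a b c) (dot-⊕ f x y) ⟩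
  ((a ∧ b) xor (a ∧ c)) xor (dot f x xor dot f y)
    ≡⟨ xor-interchange (a ∧ b) (a ∧ c) (dot f x) (dot f y) ⟩
  ((a ∧ b) xor dot f x) xor ((a ∧ c) xor dot f y) ∎
  where open ≡-Reasoning

dot-· : ∀ {n} (f : F₂^ n) c x → dot f (c · x) ≡ c ∧ dot f x
dot-· f false x = dot-𝟎ʳ f
dot-· f true  x = refl

dot-span : ∀ {n d} (f : F₂^ n) (w : Fin d → F₂^ n) → (∀ j → dot f (w j) ≡ false) →
           ∀ {x} → InSpan w x → dot f x ≡ false
dot-span f w f⊥w (c , refl) = dot-Σ (λ j → c j · w j) λ j →
    trans (dot-· f (c j) (w j)) (trans (cong (c j ∧_) (f⊥w j)) (∧-zeroʳ (c j)))
  where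
  dot-Σ : ∀ {m} (g : Fin m → F₂^ _) → (∀ j → dot f (g j) ≡ false) → dot f (Σᵥ g) ≡ false
  dot-Σ {zero}  g f⊥g = dot-𝟎ʳ f
  dot-Σ {suc m} g f⊥g = trans (dot-⊕ f (g zero) (Σᵥ (g ∘ suc)))
                              (cong₂ _xor_ (f⊥g zero) (dot-Σ (g ∘ suc) (f⊥g ∘ suc)))

insertAt-⊕ : ∀ {n} (x y : F₂^ n) t a b → insertAt x t a ⊕ insertAt y t b ≡ insertAt (x ⊕ y) t (a xor b)
insertAt-⊕ x       y       zero    a b = refl
insertAt-⊕ (c ∷ x) (d ∷ y) (suc t) a b = cong ((c xor d) ∷_) (insertAt-⊕ x y t a b)

insertAt-𝟎 : ∀ {n} (t : Fin (suc n)) → insertAt 𝟎 t false ≡ 𝟎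
insertAt-𝟎         zero    = refl
insertAt-𝟎 {suc n} (suc t) = cong (false ∷_) (insertAt-𝟎 t)

removeAt-⊕ : ∀ {n} (x y : F₂^ (suc n)) t → removeAt (x ⊕ y) t ≡ removeAt x t ⊕ removeAt y t
removeAt-⊕         (a ∷ x) (b ∷ y) zero    = refl
removeAt-⊕ {suc n} (a ∷ x@(_ ∷ _)) (b ∷ y@(_ ∷ _)) (suc t) = cong ((a xor b) ∷_) (removeAt-⊕ x y t)

removeAt-𝟎 : ∀ {n} (t : Fin (suc n)) → removeAt 𝟎 t ≡ 𝟎
removeAt-𝟎         zero    = refl
removeAt-𝟎 {suc n} (suc t) = cong (false ∷_) (removeAt-𝟎 t)

dot-insertAt : ∀ {n} (f x : F₂^ n) t a b → dot (insertAt f t a) (insertAt x t b) ≡ (a ∧ b) xor dot f x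
dot-insertAt f       x       zero    a b = refl
dot-insertAt (c ∷ f) (d ∷ x) (suc t) a b = begin
  (c ∧ d) xor dot (insertAt f t a) (insertAt x t b) ≡⟨ cong ((c ∧ d) xor_) (dot-insertAt f x t a b) ⟩
  (c ∧ d) xor ((a ∧ b) xor dot f x)                 ≡⟨ sym (xor-assoc (c ∧ d) (a ∧ b) (dot f x)) ⟩
  ((c ∧ d) xor (a ∧ b)) xor dot f x                 ≡⟨ cong (_xor dot f x) (xor-comm (c ∧ d) (a ∧ b)) ⟩
  ((a ∧ b) xor (c ∧ d)) xor dot f x                 ≡⟨ xor-assoc (a ∧ b) (c ∧ d) (dot f x) ⟩
  (a ∧ b) xor ((c ∧ d) xor dot f x)                 ∎
  where open ≡-Reasoning

-- Any d ≤ m vectors of F₂^(m+1) lie in a common hyperplane, given as the kernel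
-- of a linear form f = insertAt f' t true whose t-th coefficient is 1.
-- Proof by Gaussian elimination: if some w j₀ has first coordinate 1, subtract it
-- from the others to clear their first coordinates, recurse on the d - 1 tails,
-- and choose the first coefficient of f so that f also vanishes on w j₀.
annihilator : ∀ {d m} → d ≤ m → (w : Fin d → F₂^ (suc m)) →
  Σ (Fin (suc m)) λ t → Σ (F₂^ m) λ f' → ∀ j → dot (insertAt f' t true) (w j) ≡ false
annihilator {zero}          _          w = zero , 𝟎 , λ ()
annihilator {suc d} {suc m} (s≤s d≤m) w with any? (λ j → head (w j) Bool.≟ true)
... | no noPivot = zero , 𝟎 , λ j → begin
  dot (true ∷ 𝟎) (w j)               ≡⟨ dot-∷ true 𝟎 (w j) ⟩
  head (w j) xor dot 𝟎 (tail (w j)) ≡⟨ cong₂ _xor_ (¬-not (noPivot ∘ (j ,_))) (dot-𝟎ˡ (tail (w j))) ⟩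
  false                             ∎
  where open ≡-Reasoning
... | yes (j₀ , pivot) = suc t , (c ∷ g') , vanishes
  where
  cleared : Fin (suc d) → F₂^ (suc m)
  cleared j = tail (w j) ⊕ (head (w j) · tail (w j₀))

  recursive : Σ (Fin (suc m)) λ t → Σ (F₂^ m) λ g' →
                ∀ j → dot (insertAt g' t true) (cleared (punchIn j₀ j)) ≡ false
  recursive = annihilator d≤m (cleared ∘ punchIn j₀)
  t : Fin (suc m)
  t = proj₁ recursive
  g' : F₂^ m
  g' = proj₁ (proj₂ recursive)
  g : F₂^ (suc m)
  g = insertAt g' t true
  -- the first coefficient of f, making f vanish on w j₀
  c : Bool
  c = dot g (tail (w j₀))

  elimination : ∀ j → dot (c ∷ g) (w j) ≡ dot g (cleared j)
  elimination j = begin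
    dot (c ∷ g) (w j)                                  ≡⟨ dot-∷ c g (w j) ⟩
    (c ∧ head (w j)) xor dot g (tail (w j))            ≡⟨ xor-comm (c ∧ head (w j)) (dot g (tail (w j))) ⟩
    dot g (tail (w j)) xor (c ∧ head (w j))            ≡⟨ cong (dot g (tail (w j)) xor_) (∧-comm c (head (w j))) ⟩
    dot g (tail (w j)) xor (head (w j) ∧ c)            ≡⟨ cong (dot g (tail (w j)) xor_) (sym (dot-· g (head (w j)) (tail (w j₀)))) ⟩
    dot g (tail (w j)) xor dot g (head (w j) · tail (w j₀)) ≡⟨ sym (dot-⊕ g (tail (w j)) _) ⟩
    dot g (cleared j)                                  ∎
    where open ≡-Reasoning

  vanishes : ∀ j → dot (c ∷ g) (w j) ≡ false
  vanishes j with j₀ Fin.≟ j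
  ... | yes refl = trans (elimination j₀) (begin
    dot g (tail (w j₀) ⊕ (head (w j₀) · tail (w j₀))) ≡⟨ cong (λ b → dot g (tail (w j₀) ⊕ (b · tail (w j₀)))) pivot ⟩
    dot g (tail (w j₀) ⊕ tail (w j₀))                 ≡⟨ cong (dot g) (⊕-self (tail (w j₀))) ⟩
    dot g 𝟎                                           ≡⟨ dot-𝟎ʳ g ⟩
    false                                             ∎)
    where open ≡-Reasoning
  ... | no j₀≢j = trans (elimination j)
    (subst (λ i → dot g (cleared i) ≡ false) (punchIn-punchOut j₀≢j) (proj₂ (proj₂ recursive) (punchOut j₀≢j)))

-- The hyperplane H = ker f of f = insertAt f' t true and its complement e ⊕ H,
-- where e is the t-th unit vector.  Deleting coordinate t (π) identifies both with
-- F₂^m; the inverses are ι y = insertAt y t ⟨f', y⟩ and ι' y = e ⊕ ι y.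
module Hyperplane {m} (t : Fin (suc m)) (f' : F₂^ m) where

  f : F₂^ (suc m)
  f = insertAt f' t true

  π : F₂^ (suc m) → F₂^ m
  π x = removeAt x t

  ι : F₂^ m → F₂^ (suc m)
  ι y = insertAt y t (dot f' y)

  e : F₂^ (suc m)
  e = insertAt 𝟎 t true

  ι' : F₂^ m → F₂^ (suc m)
  ι' y = e ⊕ ι y

  dot-f : ∀ y b → dot f (insertAt y t b) ≡ b xor dot f' y
  dot-f y b = dot-insertAt f' y t true b

  dot-f-ι : ∀ y → dot f (ι y) ≡ false
  dot-f-ι y = trans (dot-f y (dot f' y)) (xor-same (dot f' y))

  dot-f-ι' : ∀ y → dot f (ι' y) ≡ true
  dot-f-ι' y = begin
    dot f (e ⊕ ι y)            ≡⟨ dot-⊕ f e (ι y) ⟩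
    dot f e xor dot f (ι y)    ≡⟨ cong₂ _xor_ (trans (dot-f 𝟎 true) (cong (true xor_) (dot-𝟎ʳ f'))) (dot-f-ι y) ⟩
    true                       ∎
    where open ≡-Reasoning

  π-⊕ : ∀ x y → π (x ⊕ y) ≡ π x ⊕ π y
  π-⊕ x y = removeAt-⊕ x y t

  π-ι : ∀ y → π (ι y) ≡ y
  π-ι y = removeAt-insertAt y t (dot f' y)

  π-ι' : ∀ y → π (ι' y) ≡ y
  π-ι' y = begin
    π (e ⊕ ι y)     ≡⟨ π-⊕ e (ι y) ⟩
    π e ⊕ π (ι y)   ≡⟨ cong₂ _⊕_ (removeAt-insertAt 𝟎 t true) (π-ι y) ⟩
    𝟎 ⊕ y           ≡⟨ ⊕-identityˡ y ⟩
    y               ∎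
    where open ≡-Reasoning

  ι-injective : ∀ {a b} → ι a ≡ ι b → a ≡ b
  ι-injective {a} {b} ιa≡ιb = trans (sym (π-ι a)) (trans (cong π ιa≡ιb) (π-ι b))

  ι'-injective : ∀ {a b} → ι' a ≡ ι' b → a ≡ b
  ι'-injective {a} {b} ι'a≡ι'b = trans (sym (π-ι' a)) (trans (cong π ι'a≡ι'b) (π-ι' b))

  ι-⊕ : ∀ a b → ι a ⊕ ι b ≡ ι (a ⊕ b)
  ι-⊕ a b = trans (insertAt-⊕ a b t (dot f' a) (dot f' b)) (cong (insertAt (a ⊕ b) t) (sym (dot-⊕ f' a b)))

  ι'-⊕ : ∀ a b → ι' a ⊕ ι' b ≡ ι (a ⊕ b)
  ι'-⊕ a b = begin
    (e ⊕ ι a) ⊕ (e ⊕ ι b) ≡⟨ ⊕-interchange e (ι a) e (ι b) ⟩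
    (e ⊕ e) ⊕ (ι a ⊕ ι b) ≡⟨ cong₂ _⊕_ (⊕-self e) (ι-⊕ a b) ⟩
    𝟎 ⊕ ι (a ⊕ b)         ≡⟨ ⊕-identityˡ (ι (a ⊕ b)) ⟩
    ι (a ⊕ b)             ∎
    where open ≡-Reasoning

  decompose : ∀ x → insertAt (π x) t (dot f x xor dot f' (π x)) ≡ x
  decompose x = trans (cong (insertAt (π x) t) coordinate-t) (insertAt-removeAt x t)
    where
    coordinate-t : dot f x xor dot f' (π x) ≡ lookup x t
    coordinate-t = begin
      dot f x xor dot f' (π x)
        ≡⟨ cong (λ z → dot f z xor dot f' (π x)) (sym (insertAt-removeAt x t)) ⟩
      dot f (insertAt (π x) t (lookup x t)) xor dot f' (π x)
        ≡⟨ cong (_xor dot f' (π x)) (dot-f (π x) (lookup x t)) ⟩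
      (lookup x t xor dot f' (π x)) xor dot f' (π x)
        ≡⟨ xor-assoc (lookup x t) _ _ ⟩
      lookup x t xor (dot f' (π x) xor dot f' (π x))
        ≡⟨ cong (lookup x t xor_) (xor-same (dot f' (π x))) ⟩
      lookup x t xor false
        ≡⟨ xor-identityʳ (lookup x t) ⟩
      lookup x t ∎
      where open ≡-Reasoning

  ι-π : ∀ x → dot f x ≡ false → ι (π x) ≡ x
  ι-π x x∈H = trans (cong (λ b → insertAt (π x) t (b xor dot f' (π x))) (sym x∈H)) (decompose x)

  ι'-π : ∀ x → dot f x ≡ true → ι' (π x) ≡ x
  ι'-π x x∉H = begin
    e ⊕ ι (π x)                                   ≡⟨ insertAt-⊕ 𝟎 (π x) t true (dot f' (π x)) ⟩
    insertAt (𝟎 ⊕ π x) t (true xor dot f' (π x))  ≡⟨ cong₂ (λ y b → insertAt y t (b xor dot f' (π x))) (⊕-identityˡ (π x)) (sym x∉H) ⟩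
    insertAt (π x) t (dot f x xor dot f' (π x))   ≡⟨ decompose x ⟩
    x                                             ∎
    where open ≡-Reasoning

  -- π is injective on H, so it keeps nonzero vectors of H nonzero
  π-nonzero : ∀ x → ¬ x ≡ 𝟎 → dot f x ≡ false → ¬ π x ≡ 𝟎
  π-nonzero x x≢𝟎 x∈H πx≡𝟎 = x≢𝟎 (begin
    x          ≡⟨ sym (ι-π x x∈H) ⟩
    ι (π x)    ≡⟨ cong ι πx≡𝟎 ⟩
    ι 𝟎        ≡⟨ cong (insertAt 𝟎 t) (dot-𝟎ʳ f') ⟩
    insertAt 𝟎 t false ≡⟨ insertAt-𝟎 t ⟩
    𝟎          ∎)
    where open ≡-Reasoning

sumL : ∀ {n} → List (F₂^ n) → F₂^ n
sumL = foldr _⊕_ 𝟎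

sumL-++ : ∀ {n} (xs ys : List (F₂^ n)) → sumL (xs ++ ys) ≡ sumL xs ⊕ sumL ys
sumL-++ []       ys = sym (⊕-identityˡ (sumL ys))
sumL-++ (x ∷ xs) ys = trans (cong (x ⊕_) (sumL-++ xs ys)) (sym (⊕-assoc x (sumL xs) (sumL ys)))

sumL-↭ : ∀ {n} {xs ys : List (F₂^ n)} → xs ↭ ys → sumL xs ≡ sumL ys
sumL-↭ Perm.refl          = refl
sumL-↭ (prep x p)         = cong (x ⊕_) (sumL-↭ p)
sumL-↭ (swap x y p)       = trans (⊕-lcomm x y _) (cong (λ z → y ⊕ (x ⊕ z)) (sumL-↭ p))
sumL-↭ (Perm.trans p q)   = trans (sumL-↭ p) (sumL-↭ q)

complement-sum : ∀ {n} {xs : List (F₂^ n)} A B → xs ↭ A ++ B → sumL xs ≡ 𝟎 → sumL A ≡ 𝟎 → sumL B ≡ 𝟎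
complement-sum {xs = xs} A B xs↭A++B sumXs sumA = begin
  sumL B             ≡⟨ sym (⊕-identityˡ (sumL B)) ⟩
  𝟎 ⊕ sumL B         ≡⟨ cong (_⊕ sumL B) (sym sumA) ⟩
  sumL A ⊕ sumL B    ≡⟨ sym (sumL-++ A B) ⟩
  sumL (A ++ B)      ≡⟨ sym (sumL-↭ xs↭A++B) ⟩
  sumL xs            ≡⟨ sumXs ⟩
  𝟎                  ∎
  where open ≡-Reasoning

Σᵥ≡sumL : ∀ {n m} (v : Fin m → F₂^ n) → Σᵥ v ≡ sumL (tabulate v)
Σᵥ≡sumL {m = zero}  v = refl
Σᵥ≡sumL {m = suc m} v = cong (v zero ⊕_) (Σᵥ≡sumL (v ∘ suc))

Σᵥ-cong : ∀ {n m} {g h : Fin m → F₂^ n} → (∀ j → g j ≡ h j) → Σᵥ g ≡ Σᵥ h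
Σᵥ-cong {m = zero}  g≗h = refl
Σᵥ-cong {m = suc m} g≗h = cong₂ _⊕_ (g≗h zero) (Σᵥ-cong (g≗h ∘ suc))

module Linear {n n'} (L : F₂^ n → F₂^ n') (L-⊕ : ∀ x y → L (x ⊕ y) ≡ L x ⊕ L y) (L-𝟎 : L 𝟎 ≡ 𝟎) where

  L-sumL : ∀ xs → L (sumL xs) ≡ sumL (map L xs)
  L-sumL []       = L-𝟎
  L-sumL (x ∷ xs) = trans (L-⊕ x (sumL xs)) (cong (L x ⊕_) (L-sumL xs))

  L-Σᵥ : ∀ {m} (g : Fin m → F₂^ n) → L (Σᵥ g) ≡ Σᵥ (L ∘ g)
  L-Σᵥ {zero}  g = L-𝟎
  L-Σᵥ {suc m} g = trans (L-⊕ (g zero) (Σᵥ (g ∘ suc))) (cong (L (g zero) ⊕_) (L-Σᵥ (g ∘ suc)))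

  L-· : ∀ b x → L (b · x) ≡ b · L x
  L-· true  x = refl
  L-· false x = L-𝟎

  L-span : ∀ {d} (w : Fin d → F₂^ n) {x} → InSpan w x → InSpan (L ∘ w) (L x)
  L-span w (c , refl) = c , trans (L-Σᵥ (λ j → c j · w j)) (Σᵥ-cong (λ j → L-· (c j) (w j)))

Enumerates : ∀ {A : Set} → List A → Set
Enumerates ys = Unique ys × (∀ y → y ∈ ys)

unique-resp-↭ : ∀ {A : Set} {xs ys : List A} → xs ↭ ys → Unique xs → Unique ys
unique-resp-↭ p = SetoidPerm.Unique-resp-↭ (setoid _) (↭⇒↭ₛ p)

enumerates-resp-↭ : ∀ {A : Set} {xs ys : List A} → xs ↭ ys → Enumerates xs → Enumerates ys
enumerates-resp-↭ p (unique , complete) = unique-resp-↭ p unique , λ y → ∈-resp-↭ p (complete y)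

complement-length : ∀ {A : Set} {xs : List A} ys zs a b → xs ↭ ys ++ zs → length xs ≡ a + b →
                    length ys ≡ a → length zs ≡ b
complement-length {xs = xs} ys zs a b xs↭ys++zs lenXs lenYs = +-cancelˡ-≡ a (length zs) b (begin
  a + length zs          ≡⟨ cong (_+ length zs) (sym lenYs) ⟩
  length ys + length zs  ≡⟨ sym (length-++ ys) ⟩
  length (ys ++ zs)      ≡⟨ sym (↭-length xs↭ys++zs) ⟩
  length xs              ≡⟨ lenXs ⟩
  a + b                  ∎)
  where open ≡-Reasoning

extract : ∀ {A : Set} {x : A} {ys} → x ∈ ys → Σ (List A) λ rest → ys ↭ x ∷ rest
extract {x = x} x∈ys with ys₁ , ys₂ , refl ← ∈-∃++ x∈ys = ys₁ ++ ys₂ , shift x ys₁ ys₂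

∈-tail : ∀ {A : Set} {z x : A} {xs} → z ∈ x ∷ xs → z ≢ x → z ∈ xs
∈-tail (here z≡x)  z≢x = ⊥-elim (z≢x z≡x)
∈-tail (there z∈xs) _  = z∈xs

unique-∷ : ∀ {A : Set} {x : A} {xs} → x ∉ xs → Unique xs → Unique (x ∷ xs)
unique-∷ {xs = xs} x∉xs unique = ¬Any⇒All¬ xs x∉xs ∷ unique

unique-++⁻ʳ : ∀ {A : Set} (xs : List A) {ys} → Unique (xs ++ ys) → Unique ys
unique-++⁻ʳ []       unique       = unique
unique-++⁻ʳ (x ∷ xs) (_ ∷ unique) = unique-++⁻ʳ xs unique

∉-∷ : ∀ {A : Set} {z x : A} {xs} → z ≢ x → z ∉ xs → z ∉ x ∷ xs
∉-∷ z≢x z∉xs (here z≡x)  = z≢x z≡x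
∉-∷ z≢x z∉xs (there z∈xs) = z∉xs z∈xs

unique-length-≤ : ∀ {A : Set} (xs ys : List A) → Unique xs → (∀ {x} → x ∈ xs → x ∈ ys) →
                  length xs ≤ length ys
unique-length-≤ []       ys _                 _    = z≤n
unique-length-≤ (x ∷ xs) ys (x∉xs ∷ unique) xs⊆ys with rest , ys↭ ← extract (xs⊆ys (here refl)) =
  ≤-trans (s≤s (unique-length-≤ xs rest unique xs⊆rest)) (≤-reflexive (sym (↭-length ys↭)))
  where
  xs⊆rest : ∀ {z} → z ∈ xs → z ∈ rest
  xs⊆rest {z} z∈xs with ∈-resp-↭ ys↭ (xs⊆ys (there z∈xs))
  ... | here z≡x     = ⊥-elim (All.lookup x∉xs z∈xs (sym z≡x))
  ... | there z∈rest = z∈rest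

allVectors : ∀ n → List (F₂^ n)
allVectors zero    = [] ∷ []
allVectors (suc n) = map (false ∷_) (allVectors n) ++ map (true ∷_) (allVectors n)

length-allVectors : ∀ n → length (allVectors n) ≡ 2 ^ n
length-allVectors zero    = refl
length-allVectors (suc n) = begin
  length (map (false ∷_) (allVectors n) ++ map (true ∷_) (allVectors n))
    ≡⟨ length-++ (map (false ∷_) (allVectors n)) ⟩
  length (map (false ∷_) (allVectors n)) + length (map (true ∷_) (allVectors n))
    ≡⟨ cong₂ _+_ (length-map (false ∷_) (allVectors n)) (length-map (true ∷_) (allVectors n)) ⟩
  length (allVectors n) + length (allVectors n)
    ≡⟨ cong (λ l → l + l) (length-allVectors n) ⟩
  2 ^ n + 2 ^ n
    ≡⟨ cong (2 ^ n +_) (sym (+-identityʳ (2 ^ n))) ⟩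
  2 ^ suc n ∎
  where open ≡-Reasoning

∈-allVectors : ∀ {n} (x : F₂^ n) → x ∈ allVectors n
∈-allVectors []                = here refl
∈-allVectors {suc n} (false ∷ x) = ∈-++⁺ˡ (∈-map⁺ (false ∷_) (∈-allVectors x))
∈-allVectors {suc n} (true ∷ x)  = ∈-++⁺ʳ (map (false ∷_) (allVectors n)) (∈-map⁺ (true ∷_) (∈-allVectors x))

unique-length-≤-2^ : ∀ {n} (xs : List (F₂^ n)) → Unique xs → length xs ≤ 2 ^ n
unique-length-≤-2^ {n} xs unique =
  ≤-trans (unique-length-≤ xs (allVectors n) unique (λ {x} _ → ∈-allVectors x)) (≤-reflexive (length-allVectors n))

-- A multiset of 2^(m+2) nonzero vectors of F₂^(m+2) with zero sum is written
-- as doubled pairs plus a set S.  Pairs have zero sum, so if S is small a zero-sum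
-- half is S plus some pairs; if S is large it contains zero-sum quadruples, which are
-- moved to the other half until S is small enough.

doubled : ∀ {A : Set} → List A → List A
doubled []       = []
doubled (a ∷ as) = a ∷ a ∷ doubled as

doubled-sum : ∀ {n} (as : List (F₂^ n)) → sumL (doubled as) ≡ 𝟎
doubled-sum []       = refl
doubled-sum (a ∷ as) = trans (⊕-inverseˡ a (sumL (doubled as))) (doubled-sum as)

doubled-length : ∀ {A : Set} (as : List A) → length (doubled as) ≡ length as + length as
doubled-length []       = refl
doubled-length (a ∷ as) = cong suc (trans (cong suc (doubled-length as)) (sym (+-suc (length as) (length as))))

doubled-++ : ∀ {A : Set} (as bs : List A) → doubled (as ++ bs) ≡ doubled as ++ doubled bs
doubled-++ []       bs = refl
doubled-++ (a ∷ as) bs = cong (λ l → a ∷ a ∷ l) (doubled-++ as bs)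

pairOff : ∀ {A : Set} → DecidableEquality A → (xs : List A) →
  Σ (List A) λ as → Σ (List A) λ S → (xs ↭ doubled as ++ S) × Unique S
pairOff _≟_ [] = [] , [] , ↭-refl , []
pairOff _≟_ (x ∷ xs) with as , S , xs↭ , uniqueS ← pairOff _≟_ xs with DecMembership._∈?_ _≟_ x S
... | yes x∈S with R , S↭x∷R ← extract x∈S =
  x ∷ as , R , prep x (↭-trans xs↭ (↭-trans (++⁺ˡ (doubled as) S↭x∷R) (shift x (doubled as) R))) ,
  AllPairs.tail (unique-resp-↭ S↭x∷R uniqueS)
... | no x∉S = as , x ∷ S , ↭-trans (prep x xs↭) (↭-sym (shift x (doubled as) S)) , unique-∷ x∉S uniqueS

infix 4 _∈?_
_∈?_ : ∀ {n} (x : F₂^ n) (xs : List (F₂^ n)) → Dec (x ∈ xs)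
_∈?_ = DecMembership._∈?_ (≡-dec Bool._≟_)

unique-translate : ∀ {n} (c : F₂^ n) (L : List (F₂^ n)) → Unique L → (∀ {z} → z ∈ L → c ⊕ z ∉ L) →
                   Unique (L ++ map (c ⊕_) L)
unique-translate c L unique separated =
  Unique.++⁺ unique (Unique.map⁺ (⊕-injectiveˡ c) unique) disjoint
  where
  disjoint : ∀ {v} → ¬ (v ∈ L × v ∈ map (c ⊕_) L)
  disjoint (v∈L , v∈c⊕L) with z , z∈L , refl ← ∈-map⁻ (c ⊕_) v∈c⊕L = separated z∈L v∈L

record Without {n} (c : F₂^ n) (ys : List (F₂^ n)) : Set where
  field
    rest     : List (F₂^ n)
    unique   : Unique rest
    c∉rest   : c ∉ rest
    rest⊆ys  : ∀ {x} → x ∈ rest → x ∈ ys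
    length≤  : length ys ≤ suc (length rest)

without : ∀ {n} (c : F₂^ n) ys → Unique ys → Without c ys
without c ys unique with c ∈? ys
... | no c∉ys = record { rest = ys ; unique = unique ; c∉rest = c∉ys ; rest⊆ys = λ x∈ → x∈
                       ; length≤ = n≤1+n (length ys) }
... | yes c∈ys with rest , ys↭ ← extract c∈ys = record
  { rest    = rest
  ; unique  = AllPairs.tail unique'
  ; c∉rest  = Unique.Unique[x∷xs]⇒x∉xs unique'
  ; rest⊆ys = λ x∈ → ∈-resp-↭ (↭-sym ys↭) (there x∈)
  ; length≤ = ≤-reflexive (↭-length ys↭) }
  where
  unique' : Unique (c ∷ rest)
  unique' = unique-resp-↭ ys↭ unique

too-large : ∀ P r s → P + 3 ≤ (2 + r) + (2 + r) → r ≤ suc s → (2 + s) + (2 + s) ≤ P → ⊥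
too-large P r s large r≤1+s small = <-irrefl refl (begin-strict
  2 + P                         <⟨ ≤-reflexive (+-comm 3 P) ⟩
  P + 3                         ≤⟨ large ⟩
  (2 + r) + (2 + r)             ≤⟨ +-mono-≤ (s≤s (s≤s r≤1+s)) (s≤s (s≤s r≤1+s)) ⟩
  (3 + s) + (3 + s)             ≡⟨ rearrange s ⟩
  2 + ((2 + s) + (2 + s))       ≤⟨ s≤s (s≤s small) ⟩
  2 + P                         ∎)
  where
  open ≤-Reasoning
  rearrange : ∀ s → (3 + s) + (3 + s) ≡ 2 + ((2 + s) + (2 + s))
  rearrange = solve-∀

-- The counting half of zeroSumQuadruple.  Let a ≠ b be nonzero, c = a ⊕ b, and S₀ a
-- set of nonzero vectors avoiding a, b and c that contains no pair x, c ⊕ x.  Then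
-- 0, a, S₀ and their translates c, b, c ⊕ S₀ are 2(|S₀| + 2) distinct vectors.
translateBound : ∀ {m} (a b : F₂^ m) (S₀ : List (F₂^ m)) → a ≢ b → a ≢ 𝟎 → b ≢ 𝟎 →
  a ∉ S₀ → b ∉ S₀ → a ⊕ b ∉ S₀ → Unique S₀ → All Nonzero S₀ →
  (∀ {x} → x ∈ S₀ → (a ⊕ b) ⊕ x ∉ S₀) → (2 + length S₀) + (2 + length S₀) ≤ 2 ^ m
translateBound {m} a b S₀ a≢b a≢𝟎 b≢𝟎 a∉S₀ b∉S₀ c∉S₀ uniqueS₀ nonzeroS₀ noPair = begin
  (2 + length S₀) + (2 + length S₀)  ≡⟨ cong (length L +_) (sym (length-map (c ⊕_) L)) ⟩
  length L + length (map (c ⊕_) L)  ≡⟨ sym (length-++ L) ⟩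
  length (L ++ map (c ⊕_) L)        ≤⟨ unique-length-≤-2^ (L ++ map (c ⊕_) L) (unique-translate c L uniqueL separated) ⟩
  2 ^ m                             ∎
  where
  open ≤-Reasoning
  c : F₂^ m
  c = a ⊕ b
  L : List (F₂^ m)
  L = 𝟎 ∷ a ∷ S₀
  c⊕a≡b : c ⊕ a ≡ b
  c⊕a≡b = trans (cong (_⊕ a) (⊕-comm a b)) (⊕-inverseʳ a b)
  c∉L : c ∉ L
  c∉L = ∉-∷ (λ c≡𝟎 → a≢b (⊕≡𝟎⇒≡ a b c≡𝟎))
            (∉-∷ (λ c≡a → b≢𝟎 (⊕-injectiveˡ a (trans c≡a (sym (⊕-identityʳ a))))) c∉S₀)
  b∉L : b ∉ L
  b∉L = ∉-∷ b≢𝟎 (∉-∷ (λ b≡a → a≢b (sym b≡a)) b∉S₀)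
  𝟎∉S₀ : 𝟎 ∉ S₀
  𝟎∉S₀ 𝟎∈S₀ = All.lookup nonzeroS₀ 𝟎∈S₀ refl
  uniqueL : Unique L
  uniqueL = unique-∷ (∉-∷ (λ 𝟎≡a → a≢𝟎 (sym 𝟎≡a)) 𝟎∉S₀) (unique-∷ a∉S₀ uniqueS₀)
  separated : ∀ {z} → z ∈ L → c ⊕ z ∉ L
  separated (here refl)         = subst (_∉ L) (sym (⊕-identityʳ c)) c∉L
  separated (there (here refl)) = subst (_∉ L) (sym c⊕a≡b) b∉L
  separated {z} (there (there z∈S₀)) = ∉-∷ c⊕z≢𝟎 (∉-∷ c⊕z≢a (noPair z∈S₀))
    where
    c⊕z≢𝟎 : c ⊕ z ≢ 𝟎
    c⊕z≢𝟎 c⊕z≡𝟎 = c∉S₀ (subst (_∈ S₀) (sym (⊕≡𝟎⇒≡ c z c⊕z≡𝟎)) z∈S₀)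
    c⊕z≢a : c ⊕ z ≢ a
    c⊕z≢a c⊕z≡a = b∉S₀ (subst (_∈ S₀) (trans (⊕-transpose c z a c⊕z≡a) c⊕a≡b) z∈S₀)

ZeroSumQuadruple : ∀ {m} → List (F₂^ m) → Set
ZeroSumQuadruple {m} S =
  Σ (List (F₂^ m)) λ Q → Σ (List (F₂^ m)) λ R → (S ↭ Q ++ R) × length Q ≡ 4 × sumL Q ≡ 𝟎

-- If a duplicate-free set S of nonzero vectors of F₂^m has more than 2^(m-1) + 1
-- elements, four distinct elements of S sum to zero: with a, b the first two and
-- c = a ⊕ b, some x, c ⊕ x lie in S₀ = S ∖ {a, b, c}, by translateBound.
zeroSumQuadruple : ∀ {m} (S : List (F₂^ m)) → Unique S → All Nonzero S →
  2 ^ m + 3 ≤ length S + length S → ZeroSumQuadruple S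
zeroSumQuadruple {m} [] _ _ large = ⊥-elim (3≰0 (m+n≤o⇒n≤o (2 ^ m) large))
  where 3≰0 : ¬ 3 ≤ 0
        3≰0 ()
zeroSumQuadruple {m} (_ ∷ []) _ _ large = ⊥-elim (3≰2 (m+n≤o⇒n≤o (2 ^ m) large))
  where 3≰2 : ¬ 3 ≤ 2
        3≰2 (s≤s (s≤s ()))
zeroSumQuadruple {m} (a ∷ b ∷ ys) ((a≢b ∷ a∉ys) ∷ (b∉ys ∷ uniqueYs)) (a≢𝟎 ∷ b≢𝟎 ∷ ys≢𝟎) large =
  decide (Any.any? (λ x → c ⊕ x ∈? S₀) S₀)
  where
  c : F₂^ m
  c = a ⊕ b
  open Without (without c ys uniqueYs) renaming (rest to S₀; unique to uniqueS₀; c∉rest to c∉S₀; rest⊆ys to S₀⊆ys)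

  c⊕x≢x : ∀ x → c ⊕ x ≢ x
  c⊕x≢x x c⊕x≡x = a≢b (⊕≡𝟎⇒≡ a b (⊕-injectiveˡ x (trans (trans (⊕-comm x c) c⊕x≡x) (sym (⊕-identityʳ x)))))

  zeroSum : ∀ x → a ⊕ (b ⊕ (x ⊕ ((c ⊕ x) ⊕ 𝟎))) ≡ 𝟎
  zeroSum x = begin
    a ⊕ (b ⊕ (x ⊕ ((c ⊕ x) ⊕ 𝟎))) ≡⟨ sym (⊕-assoc a b _) ⟩
    c ⊕ (x ⊕ ((c ⊕ x) ⊕ 𝟎))       ≡⟨ cong (λ z → c ⊕ (x ⊕ z)) (⊕-identityʳ (c ⊕ x)) ⟩
    c ⊕ (x ⊕ (c ⊕ x))             ≡⟨ cong (c ⊕_) (⊕-lcomm x c x) ⟩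
    c ⊕ (c ⊕ (x ⊕ x))             ≡⟨ ⊕-inverseˡ c (x ⊕ x) ⟩
    x ⊕ x                         ≡⟨ ⊕-self x ⟩
    𝟎                             ∎
    where open ≡-Reasoning

  decide : Dec (Any (λ x → c ⊕ x ∈ S₀) S₀) → ZeroSumQuadruple (a ∷ b ∷ ys)
  decide (yes found) with x , x∈S₀ , y∈S₀ ← find found
                     with r , ys↭x∷r ← extract (S₀⊆ys x∈S₀)
                     with R , r↭y∷R ← extract (∈-tail (∈-resp-↭ ys↭x∷r (S₀⊆ys y∈S₀)) (c⊕x≢x x)) =
    (a ∷ b ∷ x ∷ c ⊕ x ∷ []) , R , prep a (prep b (↭-trans ys↭x∷r (prep x r↭y∷R))) , refl , zeroSum x
  decide (no noPair) = ⊥-elim (too-large (2 ^ m) (length ys) (length S₀) large length≤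
    (translateBound a b S₀ a≢b a≢𝟎 b≢𝟎 (λ a∈S₀ → All.lookup a∉ys (S₀⊆ys a∈S₀) refl)
       (λ b∈S₀ → All.lookup b∉ys (S₀⊆ys b∈S₀) refl) c∉S₀ uniqueS₀
       (All.tabulate (λ z∈S₀ → All.lookup ys≢𝟎 (S₀⊆ys z∈S₀)))
       (λ x∈S₀ c⊕x∈S₀ → noPair (lose x∈S₀ c⊕x∈S₀))))

ZeroSumPart : ∀ {n} → ℕ → List (F₂^ n) → Set
ZeroSumPart {n} h L =
  Σ (List (F₂^ n)) λ T → Σ (List (F₂^ n)) λ R → (L ↭ T ++ R) × length T ≡ h + h × sumL T ≡ 𝟎

-- If the set part S (of size 2r) is small, r ≤ h, take all of S and h - r pairs.
setAndPairs : ∀ {n} h (as S : List (F₂^ n)) r → length S ≡ r + r → sumL S ≡ 𝟎 →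
  r ≤ h → h ≤ r + length as → ZeroSumPart h (doubled as ++ S)
setAndPairs h as S r lenS sumS r≤h h≤r+A =
  S ++ doubled (take j as) , doubled (drop j as) , permutation , lengthT , sumT
  where
  j : ℕ
  j = h ∸ r
  lengthTake : length (take j as) ≡ j
  lengthTake = trans (length-take j as) (m≤n⇒m⊓n≡m (m≤n+o⇒m∸n≤o h r h≤r+A))
  permutation : doubled as ++ S ↭ (S ++ doubled (take j as)) ++ doubled (drop j as)
  permutation = ↭-trans (++-comm (doubled as) S) (↭-reflexive (begin
    S ++ doubled as                                    ≡⟨ cong (λ l → S ++ doubled l) (sym (take++drop≡id j as)) ⟩
    S ++ doubled (take j as ++ drop j as)              ≡⟨ cong (S ++_) (doubled-++ (take j as) (drop j as)) ⟩
    S ++ (doubled (take j as) ++ doubled (drop j as))  ≡⟨ sym (++-assoc S _ _) ⟩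
    (S ++ doubled (take j as)) ++ doubled (drop j as)  ∎))
    where open ≡-Reasoning
  lengthT : length (S ++ doubled (take j as)) ≡ h + h
  lengthT = begin
    length (S ++ doubled (take j as))             ≡⟨ length-++ S ⟩
    length S + length (doubled (take j as))       ≡⟨ cong₂ _+_ lenS (trans (doubled-length (take j as)) (cong₂ _+_ lengthTake lengthTake)) ⟩
    (r + r) + (j + j)                             ≡⟨ regroup r j ⟩
    (r + j) + (r + j)                             ≡⟨ cong₂ _+_ (m+[n∸m]≡n r≤h) (m+[n∸m]≡n r≤h) ⟩
    h + h                                         ∎
    where
    open ≡-Reasoning
    regroup : ∀ r j → (r + r) + (j + j) ≡ (r + j) + (r + j)
    regroup = solve-∀
  sumT : sumL (S ++ doubled (take j as)) ≡ 𝟎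
  sumT = trans (sumL-++ S _) (trans (cong₂ _⊕_ sumS (doubled-sum (take j as))) (⊕-identityˡ 𝟎))

removeQuadruple : ∀ {m} (S : List (F₂^ m)) r → length S ≡ suc (suc r) + suc (suc r) → Unique S →
  All Nonzero S → sumL S ≡ 𝟎 → 2 ^ m + 3 ≤ length S + length S →
  Σ (List (F₂^ m)) λ Q → Σ (List (F₂^ m)) λ R →
    (S ↭ Q ++ R) × length R ≡ r + r × Unique R × All Nonzero R × sumL R ≡ 𝟎
removeQuadruple S r lenS uniqueS nonzeroS sumS large
  with Q , R , S↭Q++R , lenQ , sumQ ← zeroSumQuadruple S uniqueS nonzeroS large =
  Q , R , S↭Q++R , lenR , uniqueR , AllP.++⁻ʳ Q (All-resp-↭ S↭Q++R nonzeroS) , sumR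
  where
  lenR : length R ≡ r + r
  lenR = complement-length Q R 4 (r + r) S↭Q++R (trans lenS (regroup r)) lenQ
    where
    regroup : ∀ r → suc (suc r) + suc (suc r) ≡ 4 + (r + r)
    regroup = solve-∀
  uniqueR : Unique R
  uniqueR = unique-++⁻ʳ Q (unique-resp-↭ S↭Q++R uniqueS)
  sumR : sumL R ≡ 𝟎
  sumR = complement-sum Q R S↭Q++R sumS sumQ

setAside : ∀ {n h} (as Q R : List (F₂^ n)) {S} → S ↭ Q ++ R →
  ZeroSumPart h (doubled as ++ R) → ZeroSumPart h (doubled as ++ S)
setAside as Q R S↭Q++R (T , R' , ↭T++R' , lenT , sumT) = T , Q ++ R' , permutation , lenT , sumT
  where
  permutation : doubled as ++ _ ↭ T ++ (Q ++ R')
  permutation = ↭-trans (++⁺ˡ (doubled as) S↭Q++R) (↭-trans (shifts (doubled as) Q)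
                  (↭-trans (++⁺ˡ Q ↭T++R') (shifts Q T)))

-- Arithmetic for zeroSumPart: with h < r + 2 the set of size 2(r + 2) is large
-- enough for zeroSumQuadruple, and one spare pair keeps h ≤ r + |as|.
quadruple-room : ∀ h r → h < suc (suc r) →
  2 * (2 * h) + 3 ≤ (suc (suc r) + suc (suc r)) + (suc (suc r) + suc (suc r))
quadruple-room h r h<r+2 = begin
  2 * (2 * h) + 3                                         ≤⟨ +-monoˡ-≤ 3 (*-monoʳ-≤ 2 (*-monoʳ-≤ 2 (≤-pred h<r+2))) ⟩
  2 * (2 * suc r) + 3                                     ≤⟨ n≤1+n _ ⟩
  suc (2 * (2 * suc r) + 3)                               ≡⟨ regroup r ⟩
  (suc (suc r) + suc (suc r)) + (suc (suc r) + suc (suc r)) ∎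
  where
  open ≤-Reasoning
  regroup : ∀ r → suc (2 * (2 * suc r) + 3) ≡ (suc (suc r) + suc (suc r)) + (suc (suc r) + suc (suc r))
  regroup = solve-∀

spare-pair : ∀ h r A → h < suc (suc r) → 1 ≤ A → h ≤ r + A
spare-pair h r A h<r+2 A≥1 = ≤-trans (≤-pred h<r+2)
  (≤-trans (≤-reflexive (+-comm 1 r)) (+-monoʳ-≤ r A≥1))

-- While r > h, S is large enough for zeroSumQuadruple; such a quadruple is set
-- aside for the complement and r drops by 2.
zeroSumPart : ∀ {m} (as S : List (F₂^ (suc (suc m)))) r → length S ≡ r + r → Unique S → All Nonzero S →
  sumL S ≡ 𝟎 → 1 ≤ length as → 2 ^ m ≤ r + length as → ZeroSumPart (2 ^ m) (doubled as ++ S)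
zeroSumPart {m} as S zero          lenS _ _ sumS _ h≤ = setAndPairs (2 ^ m) as S zero lenS sumS z≤n h≤
zeroSumPart {m} as S (suc zero)    lenS _ _ sumS _ h≤ =
  setAndPairs (2 ^ m) as S 1 lenS sumS (m^n>0 2 m) h≤
zeroSumPart {m} as S (suc (suc r)) lenS uniqueS nonzeroS sumS A≥1 h≤ = decide (suc (suc r) ≤? 2 ^ m)
  where
  decide : Dec (suc (suc r) ≤ 2 ^ m) → ZeroSumPart (2 ^ m) (doubled as ++ S)
  decide (yes r≤h) = setAndPairs (2 ^ m) as S (suc (suc r)) lenS sumS r≤h h≤
  decide (no r≰h) =
    let h<r+2 : 2 ^ m < suc (suc r)
        h<r+2 = ≰⇒> r≰h
        large : 2 ^ suc (suc m) + 3 ≤ length S + length S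
        large = subst (λ l → 2 ^ suc (suc m) + 3 ≤ l + l) (sym lenS) (quadruple-room (2 ^ m) r h<r+2)
        (Q , R , S↭Q++R , lenR , uniqueR , nonzeroR , sumR) = removeQuadruple S r lenS uniqueS nonzeroS sumS large
    in setAside {h = 2 ^ m} as Q R S↭Q++R
         (zeroSumPart as R r lenR uniqueR nonzeroR sumR A≥1 (spare-pair (2 ^ m) r (length as) h<r+2 A≥1))

evenRest : ∀ A s H → (A + A) + s ≡ H + H → Σ ℕ λ r → s ≡ r + r × r + A ≡ H
evenRest zero    s H       total = H , total , +-identityʳ H
evenRest (suc A) s zero    ()
evenRest (suc A) s (suc H) total = extend (evenRest A s H (cancel total))
  where
  extend : (Σ ℕ λ r → s ≡ r + r × r + A ≡ H) → Σ ℕ λ r → s ≡ r + r × r + suc A ≡ suc H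
  extend (r , s≡r+r , r+A≡H) = r , s≡r+r , trans (+-suc r A) (cong suc r+A≡H)
  cancel : suc (A + suc A + s) ≡ suc (H + suc H) → (A + A) + s ≡ H + H
  cancel e = suc-injective (trans (cong (_+ s) (sym (+-suc A A)))
               (trans (suc-injective e) (+-suc H H)))

-- The set part of a multiset of 2^m nonzero vectors of F₂^m cannot be all of it,
-- since 𝟎 is missing: some element occurs twice.
pairExists : ∀ {m} (as S : List (F₂^ m)) {xs} → xs ↭ doubled as ++ S → length xs ≡ 2 ^ m →
             Unique S → All Nonzero S → 1 ≤ length as
pairExists (_ ∷ _) S _ _ _ _ = s≤s z≤n
pairExists {m} [] S {xs} xs↭S lenXs uniqueS nonzeroS = ⊥-elim (<-irrefl refl (begin-strict
  2 ^ m             ≡⟨ sym lenXs ⟩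
  length xs         ≡⟨ ↭-length xs↭S ⟩
  length S          <⟨ n<1+n (length S) ⟩
  length (𝟎 ∷ S)    ≤⟨ unique-length-≤-2^ (𝟎 ∷ S) (unique-∷ 𝟎∉S uniqueS) ⟩
  2 ^ m             ∎))
  where
  open ≤-Reasoning
  𝟎∉S : 𝟎 ∉ S
  𝟎∉S 𝟎∈S = All.lookup nonzeroS 𝟎∈S refl

Halves : ∀ {n} → ℕ → List (F₂^ n) → Set
Halves {n} H xs = Σ (List (F₂^ n)) λ T → Σ (List (F₂^ n)) λ R → (xs ↭ T ++ R) ×
  length T ≡ H × length R ≡ H × sumL T ≡ 𝟎 × sumL R ≡ 𝟎

halve : ∀ {m} (xs : List (F₂^ (suc (suc m)))) → length xs ≡ 2 ^ suc (suc m) → All Nonzero xs → sumL xs ≡ 𝟎 →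
  Halves (2 ^ suc m) xs
halve {m} xs lenXs nonzeroXs sumXs = fromPairOff (pairOff (≡-dec Bool._≟_) xs)
  where
  h H : ℕ
  h = 2 ^ m
  H = 2 ^ suc m
  fromPairOff : Σ (List (F₂^ (suc (suc m)))) (λ as → Σ (List (F₂^ (suc (suc m)))) λ S → (xs ↭ doubled as ++ S) × Unique S) →
                Halves H xs
  fromPairOff (as , S , xs↭ , uniqueS) = fromRest (evenRest (length as) (length S) H total)
    where
    total : (length as + length as) + length S ≡ H + H
    total = begin
      (length as + length as) + length S ≡⟨ cong (_+ length S) (sym (doubled-length as)) ⟩
      length (doubled as) + length S      ≡⟨ sym (length-++ (doubled as)) ⟩
      length (doubled as ++ S)            ≡⟨ sym (↭-length xs↭) ⟩
      length xs                           ≡⟨ lenXs ⟩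
      H + (H + 0)                         ≡⟨ cong (H +_) (+-identityʳ H) ⟩
      H + H                               ∎
      where open ≡-Reasoning
    nonzeroS : All Nonzero S
    nonzeroS = AllP.++⁻ʳ (doubled as) (All-resp-↭ xs↭ nonzeroXs)
    sumS : sumL S ≡ 𝟎
    sumS = complement-sum (doubled as) S xs↭ sumXs (doubled-sum as)
    somePair : 1 ≤ length as
    somePair = pairExists as S xs↭ lenXs uniqueS nonzeroS
    fromRest : (Σ ℕ λ r → length S ≡ r + r × r + length as ≡ H) → Halves H xs
    fromRest (r , lenS , r+A≡H) = fromPart (zeroSumPart as S r lenS uniqueS nonzeroS sumS somePair h≤r+A)
      where
      h≤r+A : h ≤ r + length as
      h≤r+A = ≤-trans (m≤m+n h (h + 0)) (≤-reflexive (sym r+A≡H))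
      fromPart : ZeroSumPart h (doubled as ++ S) → Halves H xs
      fromPart (T , R , ↭T++R , lenT , sumT) = T , R , ↭-trans xs↭ ↭T++R , lenT' , lenR , sumT , sumR
        where
        lenT' : length T ≡ H
        lenT' = trans lenT (cong (h +_) (sym (+-identityʳ h)))
        lenR : length R ≡ H
        lenR = complement-length T R H H (↭-trans xs↭ ↭T++R) (trans lenXs (cong (H +_) (+-identityʳ H))) lenT'
        sumR : sumL R ≡ 𝟎
        sumR = complement-sum T R (↭-trans xs↭ ↭T++R) sumXs sumT

pairSum : ∀ {n} → F₂^ n × F₂^ n → F₂^ n
pairSum (p , q) = p ⊕ q

flatten : ∀ {A : Set} → List (A × A) → List A
flatten ps = map proj₁ ps ++ map proj₂ ps

both : ∀ {A B : Set} → (A → B) → A × A → B × B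
both g (p , q) = g p , g q

record Pairing n (xs : List (F₂^ n)) : Set where
  constructor pairing
  field
    pairs      : List (F₂^ n × F₂^ n)
    sums       : map pairSum pairs ↭ xs
    enumerates : Enumerates (flatten pairs)

pairing-resp-↭ : ∀ {n} {xs ys : List (F₂^ n)} → xs ↭ ys → Pairing n xs → Pairing n ys
pairing-resp-↭ xs↭ys (pairing ps sums enumerates) = pairing ps (↭-trans sums xs↭ys) enumerates

flatten-↭ : ∀ {A : Set} {ps qs : List (A × A)} → ps ↭ qs → flatten ps ↭ flatten qs
flatten-↭ ps↭qs = PermProps.++⁺ (PermProps.map⁺ proj₁ ps↭qs) (PermProps.map⁺ proj₂ ps↭qs)

flatten-++ : ∀ {A : Set} (ps qs : List (A × A)) → flatten (ps ++ qs) ↭ flatten ps ++ flatten qs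
flatten-++ ps qs = begin
  map proj₁ (ps ++ qs) ++ map proj₂ (ps ++ qs)
    ≡⟨ cong₂ _++_ (map-++ proj₁ ps qs) (map-++ proj₂ ps qs) ⟩
  (map proj₁ ps ++ map proj₁ qs) ++ (map proj₂ ps ++ map proj₂ qs)
    ≡⟨ ++-assoc (map proj₁ ps) (map proj₁ qs) _ ⟩
  map proj₁ ps ++ (map proj₁ qs ++ (map proj₂ ps ++ map proj₂ qs))
    ↭⟨ ++⁺ˡ (map proj₁ ps) (shifts (map proj₁ qs) (map proj₂ ps)) ⟩
  map proj₁ ps ++ (map proj₂ ps ++ (map proj₁ qs ++ map proj₂ qs))
    ≡⟨ sym (++-assoc (map proj₁ ps) (map proj₂ ps) _) ⟩
  (map proj₁ ps ++ map proj₂ ps) ++ (map proj₁ qs ++ map proj₂ qs) ∎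
  where open Perm.PermutationReasoning

flatten-both : ∀ {A B : Set} (g : A → B) (ps : List (A × A)) → flatten (map (both g) ps) ≡ map g (flatten ps)
flatten-both g ps = begin
  map proj₁ (map (both g) ps) ++ map proj₂ (map (both g) ps)
    ≡⟨ cong₂ _++_ (trans (sym (map-∘ ps)) (map-∘ ps)) (trans (sym (map-∘ ps)) (map-∘ ps)) ⟩
  map g (map proj₁ ps) ++ map g (map proj₂ ps)
    ≡⟨ sym (map-++ g (map proj₁ ps) (map proj₂ ps)) ⟩
  map g (flatten ps) ∎
  where open ≡-Reasoning

pairSum-both : ∀ {n n'} (g h : F₂^ n → F₂^ n') → (∀ p q → g p ⊕ g q ≡ h (p ⊕ q)) →
  ∀ ps → map pairSum (map (both g) ps) ≡ map h (map pairSum ps)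
pairSum-both g h hom ps = trans (sym (map-∘ ps)) (trans (map-cong (λ (p , q) → hom p q) ps) (map-∘ ps))

-- Pairings of F₂^m
-- lift to F₂^(m+1): one into H via ι, the other into its complement via ι'.  Both
-- lifts send a pair sum s to ι s, and together the entries enumerate H ∪ (e ⊕ H).
module _ {m} (t : Fin (suc m)) (f' : F₂^ m) where
  open Hyperplane t f'
  open Linear π π-⊕ (removeAt-𝟎 t)

  InH : F₂^ (suc m) → Set
  InH x = dot f x ≡ false

  project-nonzero : ∀ {xs} → All Nonzero xs → All InH xs → All Nonzero (map π xs)
  project-nonzero nonzeroXs xs⊆H =
    AllP.map⁺ (All.zipWith (λ (x≢𝟎 , x∈H) → π-nonzero _ x≢𝟎 x∈H) (nonzeroXs , xs⊆H))

  project-sum : ∀ xs → sumL xs ≡ 𝟎 → sumL (map π xs) ≡ 𝟎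
  project-sum xs sumXs = trans (sym (L-sumL xs)) (trans (cong π sumXs) (removeAt-𝟎 t))

  project-span : ∀ {d} (w : Fin d → F₂^ (suc m)) {xs} → All (InSpan w) xs → All (InSpan (π ∘ w)) (map π xs)
  project-span w spanXs = AllP.map⁺ (All.map (L-span w) spanXs)

  ι-project : ∀ xs → All InH xs → map ι (map π xs) ≡ xs
  ι-project xs xs⊆H = trans (sym (map-∘ xs)) (map-id-local (All.map (λ {x} → ι-π x) xs⊆H))

  enumerates-lift : ∀ {A B} → Enumerates A → Enumerates B → Enumerates (map ι A ++ map ι' B)
  enumerates-lift {A} {B} (uniqueA , completeA) (uniqueB , completeB) =
    Unique.++⁺ (Unique.map⁺ ι-injective uniqueA) (Unique.map⁺ ι'-injective uniqueB) disjoint , complete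
    where
    disjoint : ∀ {v} → ¬ (v ∈ map ι A × v ∈ map ι' B)
    disjoint (v∈ιA , v∈ι'B) with a , _ , refl ← ∈-map⁻ ι v∈ιA | b , _ , ιa≡ι'b ← ∈-map⁻ ι' v∈ι'B
      with () ← trans (sym (dot-f-ι a)) (trans (cong (dot f) ιa≡ι'b) (dot-f-ι' b))
    complete : ∀ y → y ∈ map ι A ++ map ι' B
    complete y with dot f y in fy
    ... | false = ∈-++⁺ˡ (subst (_∈ map ι A) (ι-π y fy) (∈-map⁺ ι (completeA (π y))))
    ... | true  = ∈-++⁺ʳ (map ι A) (subst (_∈ map ι' B) (ι'-π y fy) (∈-map⁺ ι' (completeB (π y))))

  lift-pairings : ∀ {T R} → Pairing m T → Pairing m R → Pairing (suc m) (map ι T ++ map ι R)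
  lift-pairings {T} {R} (pairing ps sumsT enumT) (pairing qs sumsR enumR) =
    pairing (map (both ι) ps ++ map (both ι') qs) sums
      (enumerates-resp-↭ (↭-sym entries) (enumerates-lift enumT enumR))
    where
    sums : map pairSum (map (both ι) ps ++ map (both ι') qs) ↭ map ι T ++ map ι R
    sums = begin
      map pairSum (map (both ι) ps ++ map (both ι') qs)
        ≡⟨ map-++ pairSum (map (both ι) ps) (map (both ι') qs) ⟩
      map pairSum (map (both ι) ps) ++ map pairSum (map (both ι') qs)
        ≡⟨ cong₂ _++_ (pairSum-both ι ι ι-⊕ ps) (pairSum-both ι' ι ι'-⊕ qs) ⟩
      map ι (map pairSum ps) ++ map ι (map pairSum qs)
        ↭⟨ PermProps.++⁺ (PermProps.map⁺ ι sumsT) (PermProps.map⁺ ι sumsR) ⟩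
      map ι T ++ map ι R ∎
      where open Perm.PermutationReasoning
    entries : flatten (map (both ι) ps ++ map (both ι') qs) ↭ map ι (flatten ps) ++ map ι' (flatten qs)
    entries = ↭-trans (flatten-++ (map (both ι) ps) (map (both ι') qs))
                (↭-reflexive (cong₂ _++_ (flatten-both ι ps) (flatten-both ι' qs)))

asFamily : ∀ {A : Set} {N} (xs : List A) → length xs ≡ N → Σ (Fin N → A) λ x → tabulate x ≡ xs
asFamily {N = zero}  []       _   = (λ ()) , refl
asFamily {N = suc N} (a ∷ xs) len = extend (asFamily xs (suc-injective len))
  where
  extend : (Σ (Fin N → _) λ x → tabulate x ≡ xs) → Σ (Fin (suc N) → _) λ x → tabulate x ≡ a ∷ xs
  extend (x , tab≡xs) = (λ { zero → a ; (suc i) → x i }) , cong (a ∷_) tab≡xs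

unmap : ∀ {A B : Set} {N} (f : A → B) (ps : List A) (v : Fin N → B) → map f ps ≡ tabulate v →
        Σ (Fin N → A) λ g → tabulate g ≡ ps × (∀ i → f (g i) ≡ v i)
unmap {N = zero}  f []       v refl = (λ ()) , refl , λ ()
unmap {N = suc N} f (a ∷ ps) v eq = extend (unmap f ps (v ∘ suc) (∷-injectiveʳ eq))
  where
  extend : (Σ (Fin N → _) λ g → tabulate g ≡ ps × (∀ i → f (g i) ≡ v (suc i))) →
           Σ (Fin (suc N) → _) λ g → tabulate g ≡ a ∷ ps × (∀ i → f (g i) ≡ v i)
  extend (g , tab≡ps , fg≗v) = (λ { zero → a ; (suc i) → g i }) , cong (a ∷_) tab≡ps ,
                               λ { zero → ∷-injectiveˡ eq ; (suc i) → fg≗v i }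

tabulate-injective : ∀ {A : Set} {N} (g : Fin N → A) → Unique (tabulate g) → ∀ {i j} → g i ≡ g j → i ≡ j
tabulate-injective g (g₀∉ ∷ unique) {zero}  {zero}  _       = refl
tabulate-injective g (g₀∉ ∷ unique) {zero}  {suc j} g₀≡gⱼ   = ⊥-elim (All.lookup g₀∉ (∈-tabulate⁺ j) g₀≡gⱼ)
tabulate-injective g (g₀∉ ∷ unique) {suc i} {zero}  gᵢ≡g₀   = ⊥-elim (All.lookup g₀∉ (∈-tabulate⁺ i) (sym gᵢ≡g₀))
tabulate-injective g (g₀∉ ∷ unique) {suc i} {suc j} gᵢ≡gⱼ   = cong suc (tabulate-injective (g ∘ suc) unique gᵢ≡gⱼ)

unique-++⁻ : ∀ {A : Set} (xs : List A) {ys} → Unique (xs ++ ys) →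
             Unique xs × Unique ys × (∀ {z} → z ∈ xs → z ∉ ys)
unique-++⁻ []       unique = [] , unique , λ ()
unique-++⁻ (x ∷ xs) (x∉ ∷ unique) with uniqueXs , uniqueYs , disjoint ← unique-++⁻ xs unique =
  AllP.++⁻ˡ xs x∉ ∷ uniqueXs , uniqueYs , disjoint'
  where
  disjoint' : ∀ {z} → z ∈ x ∷ xs → z ∉ _
  disjoint' (here refl)  z∈ys = All.lookup (AllP.++⁻ʳ xs x∉) z∈ys refl
  disjoint' (there z∈xs) z∈ys = disjoint z∈xs z∈ys

module _ {B : Set} {N} (p q : Fin N → B) where

  bijective⇒enumerates : Bijective _≡_ _≡_ [ p , q ]′ → Enumerates (tabulate p ++ tabulate q)
  bijective⇒enumerates (injective , surjective) =
    Unique.++⁺ (Unique.tabulate⁺ (inj₁-injective ∘ injective)) (Unique.tabulate⁺ (inj₂-injective ∘ injective)) disjoint ,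
    complete
    where
    disjoint : ∀ {v} → ¬ (v ∈ tabulate p × v ∈ tabulate q)
    disjoint (v∈p , v∈q) with i , refl ← ∈-tabulate⁻ v∈p | j , pᵢ≡qⱼ ← ∈-tabulate⁻ v∈q
      with () ← injective {inj₁ i} {inj₂ j} pᵢ≡qⱼ
    complete : ∀ y → y ∈ tabulate p ++ tabulate q
    complete y with surjective y
    ... | inj₁ i , hit = ∈-++⁺ˡ (subst (_∈ tabulate p) (hit refl) (∈-tabulate⁺ i))
    ... | inj₂ i , hit = ∈-++⁺ʳ (tabulate p) (subst (_∈ tabulate q) (hit refl) (∈-tabulate⁺ i))

  enumerates⇒bijective : Enumerates (tabulate p ++ tabulate q) → Bijective _≡_ _≡_ [ p , q ]′
  enumerates⇒bijective (unique , complete) = injective , surjective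
    where
    parts : Unique (tabulate p) × Unique (tabulate q) × (∀ {z} → z ∈ tabulate p → z ∉ tabulate q)
    parts = unique-++⁻ (tabulate p) unique
    injective : ∀ {a b} → [ p , q ]′ a ≡ [ p , q ]′ b → a ≡ b
    injective {inj₁ i} {inj₁ j} eq = cong inj₁ (tabulate-injective p (proj₁ parts) eq)
    injective {inj₂ i} {inj₂ j} eq = cong inj₂ (tabulate-injective q (proj₁ (proj₂ parts)) eq)
    injective {inj₁ i} {inj₂ j} eq =
      ⊥-elim (proj₂ (proj₂ parts) (∈-tabulate⁺ i) (subst (_∈ tabulate q) (sym eq) (∈-tabulate⁺ j)))
    injective {inj₂ i} {inj₁ j} eq =
      ⊥-elim (proj₂ (proj₂ parts) (∈-tabulate⁺ j) (subst (_∈ tabulate q) eq (∈-tabulate⁺ i)))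
    surjective : ∀ y → Σ (Fin N ⊎ Fin N) λ a → ∀ {z} → z ≡ a → [ p , q ]′ z ≡ y
    surjective y with ∈-++⁻ (tabulate p) (complete y)
    ... | inj₁ y∈p with i , y≡pᵢ ← ∈-tabulate⁻ y∈p = inj₁ i , λ { refl → sym y≡pᵢ }
    ... | inj₂ y∈q with i , y≡qᵢ ← ∈-tabulate⁻ y∈q = inj₂ i , λ { refl → sym y≡qᵢ }

flatten-tabulate : ∀ {A : Set} {N} (p q : Fin N → A) → flatten (tabulate (λ i → p i , q i)) ≡ tabulate p ++ tabulate q
flatten-tabulate p q = cong₂ _++_ (map-tabulate (λ i → p i , q i) proj₁) (map-tabulate (λ i → p i , q i) proj₂)

LowRankPairing : ℕ → ℕ → Set
LowRankPairing k n = (w : Fin k → F₂^ n) (xs : List (F₂^ n)) → length xs ≡ half n →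
  All Nonzero xs → sumL xs ≡ 𝟎 → All (InSpan w) xs → Pairing n xs

base : ∀ {k} → PairingProperty k → LowRankPairing k k
base {k} pairingProperty _ xs len nonzeroXs sumXs _ with x , tab≡xs ← asFamily xs len =
  let (p , q , bijective , sums) = pairingProperty x nonzero zeroSum
  in pairing (tabulate (λ i → p i , q i))
       (↭-reflexive (trans (map-tabulate (λ i → p i , q i) pairSum) (trans (tabulate-cong sums) tab≡xs)))
       (subst Enumerates (sym (flatten-tabulate p q)) (bijective⇒enumerates p q bijective))
  where
  nonzero : ∀ i → ¬ x i ≡ 𝟎
  nonzero = AllP.tabulate⁻ (subst (All Nonzero) (sym tab≡xs) nonzeroXs)
  zeroSum : Σᵥ x ≡ 𝟎
  zeroSum = trans (Σᵥ≡sumL x) (trans (cong sumL tab≡xs) sumXs)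

step : ∀ {k n} → 2 ≤ n → k ≤ n → LowRankPairing k n → LowRankPairing k (suc n)
step {k} {suc (suc m)} (s≤s (s≤s z≤n)) k≤n induction w xs len nonzeroXs sumXs spanXs =
  inHyperplane (annihilator k≤n w)
  where
  inHyperplane : (Σ (Fin (suc (suc (suc m)))) λ t → Σ (F₂^ (suc (suc m))) λ f' →
                   ∀ j → dot (insertAt f' t true) (w j) ≡ false) → Pairing (suc (suc (suc m))) xs
  inHyperplane (t , f' , f⊥w) = fromHalves (halve ys (trans (length-map π xs) len) nonzeroYs sumYs)
    where
    open Hyperplane t f'

    xs⊆H : All (InH t f') xs
    xs⊆H = All.map (dot-span f w f⊥w) spanXs

    ys : List (F₂^ (suc (suc m)))
    ys = map π xs

    nonzeroYs : All Nonzero ys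
    nonzeroYs = project-nonzero t f' nonzeroXs xs⊆H

    sumYs : sumL ys ≡ 𝟎
    sumYs = project-sum t f' xs sumXs

    fromHalves : Halves (half (suc (suc m))) ys → Pairing (suc (suc (suc m))) xs
    fromHalves (T , R , ys↭T++R , lenT , lenR , sumT , sumR) =
      pairing-resp-↭ lifted↭xs (lift-pairings t f' pairingT pairingR)
      where
      nonzeroT++R : All Nonzero (T ++ R)
      nonzeroT++R = All-resp-↭ ys↭T++R nonzeroYs
      spanT++R : All (InSpan (π ∘ w)) (T ++ R)
      spanT++R = All-resp-↭ ys↭T++R (project-span t f' w spanXs)
      pairingT : Pairing (suc (suc m)) T
      pairingT = induction (π ∘ w) T lenT (AllP.++⁻ˡ T nonzeroT++R) sumT (AllP.++⁻ˡ T spanT++R)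
      pairingR : Pairing (suc (suc m)) R
      pairingR = induction (π ∘ w) R lenR (AllP.++⁻ʳ T nonzeroT++R) sumR (AllP.++⁻ʳ T spanT++R)
      lifted↭xs : map ι T ++ map ι R ↭ xs
      lifted↭xs = begin
        map ι T ++ map ι R   ≡⟨ sym (map-++ ι T R) ⟩
        map ι (T ++ R)       ↭⟨ PermProps.map⁺ ι (↭-sym ys↭T++R) ⟩
        map ι ys             ≡⟨ ι-project t f' xs xs⊆H ⟩
        xs                   ∎
        where open Perm.PermutationReasoning

lowRank : ∀ {k n} → 2 ≤ k → PairingProperty k → k ≤′ n → LowRankPairing k n
lowRank 2≤k pairingProperty ≤′-refl          = base pairingProperty
lowRank 2≤k pairingProperty (≤′-step k≤′n) =
  step (≤-trans 2≤k (≤′⇒≤ k≤′n)) (≤′⇒≤ k≤′n) (lowRank 2≤k pairingProperty k≤′n)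

toHasPairing : ∀ n (v : Fin (half n) → F₂^ n) → Pairing n (tabulate v) → HasPairing n v
toHasPairing n v (pairing ps sums enumerates)
  with ps' , tab≡ , ps↭ps' ← PermProps.↭-map-inv pairSum sums
  with g , tab≡ps' , sums' ← unmap pairSum ps' v (sym tab≡) =
  proj₁ ∘ g , proj₂ ∘ g ,
  enumerates⇒bijective (proj₁ ∘ g) (proj₂ ∘ g)
    (subst Enumerates (trans (cong flatten (sym tab≡ps')) (flatten-tabulate (proj₁ ∘ g) (proj₂ ∘ g)))
      (enumerates-resp-↭ (flatten-↭ ps↭ps') enumerates)) ,
  sums'

proposition4 : (k : ℕ) → 2 ≤ k → PairingProperty k →
  (n : ℕ) → k ≤ n → (v : Fin (half n) → F₂^ n) →
  ((i : Fin (half n)) → ¬ v i ≡ 𝟎) → Σᵥ v ≡ 𝟎 → DimSpan≤ v k →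
  HasPairing n v
proposition4 k 2≤k pairingProperty n k≤n v nonzero zeroSum (w , spanned) =
  toHasPairing n v
    (lowRank 2≤k pairingProperty (≤⇒≤′ k≤n) w (tabulate v) (length-tabulate v)
       (AllP.tabulate⁺ nonzero) (trans (sym (Σᵥ≡sumL v)) zeroSum) (AllP.tabulate⁺ spanned))
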